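{- Let $p$ be an odd prime, $d\ge1$ an integer such that $-1$ is a power of $p$ modulo $2d$, $t$ the smallest positive integer with $p^t\equiv-1\pmod{2d}$, $r$ an even positive integer, $q=p^{2rt}$, and $I\subset\{0,\dots,2d-1\}$ with $|I|=d$ and $I\neq\{0,2,\dots,2d-2\}$. Then the subfield $\mathbb{F}_{\sqrt{q}}$ is not a clique in $PP(q,2d,I)$.
   Context: $g$ is a fixed primitive root of $\mathbb{F}_q$; the $2d$-th cyclotomic classes are $C_j=g^j\langle g^{2d}\rangle$ (indices mod $2d$). For $I=\{m_1,\dots,m_d\}$, $PP(q,2d,I)$ is the Cayley graph on vertex set $\mathbb{F}_q$ with $x\sim y$ iff $x-y\in\bigcup_{j=1}^dC_{m_j}$. -}

module Defs where

open import Level using (0ℓ)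
import Data.Nat
open import Data.Nat using (ℕ; zero; suc) renaming (_*_ to _*ℕ_)
open import Data.Fin using (Fin; toℕ)
open import Data.Fin.Subset using (Subset; _∈_)
open import Data.Product using (Σ; ∃; _×_; _,_)
open import Relation.Nullary using (¬_)
open import Relation.Binary.PropositionalEquality using (_≡_)
import Relation.Binary.PropositionalEquality as PE
open import Algebra.Bundles using (CommutativeRing)
open import Function.Bundles using (Inverse)

record IsField (R : CommutativeRing 0ℓ 0ℓ) : Set where
  open CommutativeRing R
  field
    nontrivial : ¬ (1# ≈ 0#)
    inverse    : ∀ x → ¬ (x ≈ 0#) → ∃ λ y → (x * y) ≈ 1#

HasCardinality : CommutativeRing 0ℓ 0ℓ → ℕ → Set
HasCardinality R q = Inverse (CommutativeRing.setoid R) (PE.setoid (Fin q))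

pow : (R : CommutativeRing 0ℓ 0ℓ) → CommutativeRing.Carrier R → ℕ → CommutativeRing.Carrier R
pow R x zero    = CommutativeRing.1# R
pow R x (suc n) = CommutativeRing._*_ R x (pow R x n)

IsPrimitiveRoot : (R : CommutativeRing 0ℓ 0ℓ) → CommutativeRing.Carrier R → Set
IsPrimitiveRoot R g = ∀ x → ¬ (x ≈ 0#) → ∃ λ k → x ≈ pow R g k
  where open CommutativeRing R

-- x ∈ C_j = g^j ⟨g^{2d}⟩ (here n = 2d, j an index mod n): x = g^k with k ≡ j (mod n)
InCyclotomicClass : (R : CommutativeRing 0ℓ 0ℓ) → (g : CommutativeRing.Carrier R)
                    → (n : ℕ) → Fin n → CommutativeRing.Carrier R → Set
InCyclotomicClass R g n j x =
  ∃ λ k → ∃ λ m → (k ≡ m *ℕ n Data.Nat.+ toℕ j) × CommutativeRing._≈_ R x (pow R g k)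

-- adjacency in PP(q, n, I) (n = 2d): x ~ y iff x - y ∈ ⋃_{j ∈ I} C_j
PPAdj : (R : CommutativeRing 0ℓ 0ℓ) → (g : CommutativeRing.Carrier R)
        → (n : ℕ) → Subset n → CommutativeRing.Carrier R → CommutativeRing.Carrier R → Set
PPAdj R g n I x y = ∃ λ j → j ∈ I × InCyclotomicClass R g n j (x - y)
  where open CommutativeRing R

IsClique : (R : CommutativeRing 0ℓ 0ℓ) → (g : CommutativeRing.Carrier R)
           → (n : ℕ) → Subset n → (CommutativeRing.Carrier R → Set) → Set
IsClique R g n I S = ∀ x y → S x → S y → ¬ (x ≈ y) → PPAdj R g n I x y
  where open CommutativeRing R

-- the subfield with s elements of a field of order q (s = √q):
-- the set of roots of X^s - X
InSubfield : (R : CommutativeRing 0ℓ 0ℓ) → ℕ → CommutativeRing.Carrier R → Set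
InSubfield R s x = CommutativeRing._≈_ R (pow R x s) x

{-# OPTIONS --safe #-}
-- Write s = p^(rt), so q = s².  As p^t ≡ -1 (mod 2d) and r is even, s ≡ 1 (mod 2d).  For every e the
-- element g^((1+s)e) is a (1+s)-th power, hence lies in the subfield of order s, and it lies in the
-- class C_{2e}, because g has order q - 1 = s² - 1, a multiple of 2d, and (1+s)e ≡ 2e (mod 2d).  So if
-- that subfield were a clique, its edges from 0 would force every even index into I, and |I| = d
-- leaves no room for anything else: I would be the set of even indices.
module Submission where

open import Defs
open import Level using (0ℓ)
open import Data.Nat using (ℕ; _+_; _*_; _^_; _≤_; _<_)
open import Data.Nat.Divisibility using (_∣_)
open import Data.Nat.Primality using (Prime)
open import Data.Fin using (Fin; toℕ)
open import Data.Fin.Subset using (Subset; _∈_; ∣_∣)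
open import Data.Product using (_×_)
open import Relation.Nullary using (¬_)
open import Relation.Binary.PropositionalEquality using (_≡_)
open import Algebra.Bundles using (CommutativeRing)

open import Data.Nat using (zero; suc; _∸_; _%_; _/_; NonZero; >-nonZero; nonTrivial⇒n>1; ⌈_/2⌉; s≤s; z≤n)
import Data.Nat.Properties as ℕ
open import Data.Nat.Divisibility using (divides; _∣?_; ∣-refl; ∣m∣n⇒∣m+n)
open import Data.Nat.DivMod using ([m+kn]%n≡m%n; m<n⇒m%n≡m; m∣n⇒o%n%m≡o%m; m≡m%n+[m/n]*n; m%n<n)
open import Data.Nat.Primality using (prime⇒nonZero; prime⇒nonTrivial)
open import Data.Nat.Tactic.RingSolver using (solve-∀)
import Data.Fin as Fin
open import Data.Fin using (punchIn; punchOut; fromℕ<)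
open import Data.Fin.Properties
  using (toℕ<n; toℕ-injective; fromℕ<-injective; pigeonhole; injective⇒≤; punchIn-injective; punchInᵢ≢i; punchOut-injective)
open import Data.Fin.Subset using (inside; outside; _⊂_)
open import Data.Fin.Subset.Properties using (p⊂q⇒∣p∣<∣q∣)
open import Data.Vec using ([]; _∷_; there)
open import Data.Product using (∃; _,_; proj₁; proj₂)
open import Function.Bundles using (Inverse; Injection)
open import Function.Properties.Inverse using (Inverse⇒Injection)
open import Relation.Nullary using (yes; no; contradiction)
open import Relation.Binary.Definitions using (tri<; tri≈; tri>)
open import Relation.Binary.PropositionalEquality
  using (refl; sym; trans; cong; subst; _≢_; module ≡-Reasoning)

infix 4 _≡1[mod_]
_≡1[mod_] : ℕ → ℕ → Set
v ≡1[mod M ] = ∃ λ c → v ≡ 1 + c * M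

≡1[mod]-* : ∀ {M u v} → u ≡1[mod M ] → v ≡1[mod M ] → u * v ≡1[mod M ]
≡1[mod]-* {M} (a , refl) (b , refl) = a + b + a * b * M , expand a b M
  where
  expand : ∀ a b M → (1 + a * M) * (1 + b * M) ≡ 1 + (a + b + a * b * M) * M
  expand = solve-∀

≡1[mod]-^ : ∀ {M v} → v ≡1[mod M ] → ∀ k → v ^ k ≡1[mod M ]
≡1[mod]-^ _   zero    = 0 , refl
≡1[mod]-^ v≡1 (suc k) = ≡1[mod]-* v≡1 (≡1[mod]-^ v≡1 k)

^2≡1[mod] : ∀ {M} w .{{_ : NonZero w}} → M ∣ w + 1 → w ^ 2 ≡1[mod M ]
^2≡1[mod] {M} (suc w) (divides b w+1≡bM) = w * b , (begin
  (1 + w) ^ 2            ≡⟨ square w ⟩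
  1 + w * (1 + w + 1)    ≡⟨ cong (λ v → 1 + w * v) w+1≡bM ⟩
  1 + w * (b * M)        ≡⟨ cong (1 +_) (ℕ.*-assoc w b M) ⟨
  1 + w * b * M          ∎)
  where
  open ≡-Reasoning
  square : ∀ w → (1 + w) * ((1 + w) * 1) ≡ 1 + w * (1 + w + 1)
  square = solve-∀

^even≡1[mod] : ∀ {M} w .{{_ : NonZero w}} r → M ∣ w + 1 → 2 ∣ r → w ^ r ≡1[mod M ]
^even≡1[mod] {M} w r M∣w+1 (divides r′ refl) =
  subst (_≡1[mod M ]) (trans (ℕ.^-*-assoc w 2 r′) (cong (w ^_) (ℕ.*-comm 2 r′)))
        (≡1[mod]-^ (^2≡1[mod] w M∣w+1) r′)

[1+s]*e≡e*2[mod] : ∀ {M s} .{{_ : NonZero M}} → s ≡1[mod M ] → ∀ e → (1 + s) * e % M ≡ e * 2 % M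
[1+s]*e≡e*2[mod] {M} (c , refl) e = begin
  (2 + c * M) * e % M       ≡⟨ cong (_% M) (expand c M e) ⟩
  (e * 2 + e * c * M) % M   ≡⟨ [m+kn]%n≡m%n (e * 2) (e * c) M ⟩
  e * 2 % M                 ∎
  where
  open ≡-Reasoning
  expand : ∀ c M e → (2 + c * M) * e ≡ e * 2 + e * c * M
  expand = solve-∀

evens : ∀ n → Subset n
evens zero                = []
evens (suc zero)          = inside ∷ []
evens (suc (suc n))       = inside ∷ outside ∷ evens n

∈evens⇒even : ∀ {n} {j : Fin n} → j ∈ evens n → 2 ∣ toℕ j
∈evens⇒even {suc _}       {Fin.zero}          _                 = divides 0 refl
∈evens⇒even {suc (suc _)} {Fin.suc (Fin.suc _)} (there (there j∈)) = ∣m∣n⇒∣m+n ∣-refl (∈evens⇒even j∈)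

∣evens∣≡⌈n/2⌉ : ∀ n → ∣ evens n ∣ ≡ ⌈ n /2⌉
∣evens∣≡⌈n/2⌉ zero          = refl
∣evens∣≡⌈n/2⌉ (suc zero)    = refl
∣evens∣≡⌈n/2⌉ (suc (suc n)) = cong suc (∣evens∣≡⌈n/2⌉ n)

⊇evens⇒⊆evens : ∀ d (I : Subset (2 * d)) → ∣ I ∣ ≡ d → (∀ j → 2 ∣ toℕ j → j ∈ I) → ∀ j → j ∈ I → 2 ∣ toℕ j
⊇evens⇒⊆evens d I ∣I∣≡d evens⊆I j j∈I with 2 ∣? toℕ j
... | yes even = even
... | no  odd  = contradiction (p⊂q⇒∣p∣<∣q∣ evens⊂I) (ℕ.<-irrefl ∣evens∣≡∣I∣)
  where
  evens⊂I : evens (2 * d) ⊂ I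
  evens⊂I = (λ i∈ → evens⊆I _ (∈evens⇒even i∈)) , j , j∈I , λ j∈evens → odd (∈evens⇒even j∈evens)
  ∣evens∣≡∣I∣ : ∣ evens (2 * d) ∣ ≡ ∣ I ∣
  ∣evens∣≡∣I∣ = begin
    ∣ evens (2 * d) ∣       ≡⟨ ∣evens∣≡⌈n/2⌉ (2 * d) ⟩
    ⌈ 2 * d /2⌉             ≡⟨ cong (λ m → ⌈ d + m /2⌉) (ℕ.+-identityʳ d) ⟩
    ⌈ d + d /2⌉             ≡⟨ ℕ.n≡⌈n+n/2⌉ d ⟨
    d                       ≡⟨ ∣I∣≡d ⟨
    ∣ I ∣                   ∎
    where open ≡-Reasoning

module PowerLaws (R : CommutativeRing 0ℓ 0ℓ) where
  open CommutativeRing R renaming (_+_ to _⊕_; _*_ to _·_; refl to ≈-refl; sym to ≈-sym; trans to ≈-trans)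
  open import Algebra.Properties.Semiring.Exp semiring
    using (^-congˡ; ^-homo-*; ^-assocʳ) renaming (_^_ to _^ˢ_)
  open import Relation.Binary.Reasoning.Setoid setoid

  pow≡^ : ∀ x n → pow R x n ≡ x ^ˢ n
  pow≡^ x zero    = refl
  pow≡^ x (suc n) = cong (x ·_) (pow≡^ x n)

  pow-congˡ : ∀ {x y} n → x ≈ y → pow R x n ≈ pow R y n
  pow-congˡ {x} {y} n x≈y rewrite pow≡^ x n | pow≡^ y n = ^-congˡ n x≈y

  pow-homo-* : ∀ x m n → pow R x (m + n) ≈ pow R x m · pow R x n
  pow-homo-* x m n rewrite pow≡^ x (m + n) | pow≡^ x m | pow≡^ x n = ^-homo-* x m n

  pow-assocʳ : ∀ x m n → pow R (pow R x m) n ≈ pow R x (m * n)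
  pow-assocʳ x m n rewrite pow≡^ (pow R x m) n | pow≡^ x m | pow≡^ x (m * n) = ^-assocʳ x m n

  pow-1# : ∀ n → pow R 1# n ≈ 1#
  pow-1# zero    = ≈-refl
  pow-1# (suc n) = ≈-trans (*-identityˡ _) (pow-1# n)

  pow-% : ∀ {x} n .{{_ : NonZero n}} → pow R x n ≈ 1# → ∀ a → pow R x a ≈ pow R x (a % n)
  pow-% {x} n xⁿ≈1 a = begin
    pow R x a                                     ≡⟨ cong (pow R x) (m≡m%n+[m/n]*n a n) ⟩
    pow R x (a % n + a / n * n)                   ≈⟨ pow-homo-* x (a % n) (a / n * n) ⟩
    pow R x (a % n) · pow R x (a / n * n)         ≡⟨ cong (λ k → pow R x (a % n) · pow R x k) (ℕ.*-comm (a / n) n) ⟩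
    pow R x (a % n) · pow R x (n * (a / n))       ≈⟨ *-congˡ (pow-assocʳ x n (a / n)) ⟨
    pow R x (a % n) · pow R (pow R x n) (a / n)   ≈⟨ *-congˡ (≈-trans (pow-congˡ (a / n) xⁿ≈1) (pow-1# (a / n))) ⟩
    pow R x (a % n) · 1#                          ≈⟨ *-identityʳ _ ⟩
    pow R x (a % n)                               ∎

  0#-InSubfield : ∀ {s} → 1 ≤ s → InSubfield R s 0#
  0#-InSubfield {suc _} _ = zeroˡ _

  InSubfield-pow : ∀ {s y} e → InSubfield R s y → InSubfield R s (pow R y e)
  InSubfield-pow {s} {y} e yˢ≈y = begin
    pow R (pow R y e) s   ≈⟨ pow-assocʳ y e s ⟩
    pow R y (e * s)       ≡⟨ cong (pow R y) (ℕ.*-comm e s) ⟩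
    pow R y (s * e)       ≈⟨ pow-assocʳ y s e ⟨
    pow R (pow R y s) e   ≈⟨ pow-congˡ e yˢ≈y ⟩
    pow R y e             ∎

  -- x^(1+s) is the norm of x down to the subfield of order s
  pow[1+s]-InSubfield : ∀ {s N x} → s * s ≡ suc N → pow R x N ≈ 1# → InSubfield R s (pow R x (1 + s))
  pow[1+s]-InSubfield {s} {N} {x} s*s≡1+N xᴺ≈1 = begin
    pow R (pow R x (1 + s)) s       ≈⟨ pow-assocʳ x (1 + s) s ⟩
    pow R x ((1 + s) * s)           ≡⟨ cong (pow R x) exponent ⟩
    pow R x ((1 + s) + N)           ≈⟨ pow-homo-* x (1 + s) N ⟩
    pow R x (1 + s) · pow R x N     ≈⟨ *-congˡ xᴺ≈1 ⟩
    pow R x (1 + s) · 1#            ≈⟨ *-identityʳ _ ⟩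
    pow R x (1 + s)                 ∎
    where
    exponent : (1 + s) * s ≡ (1 + s) + N
    exponent = trans (cong (s +_) s*s≡1+N) (ℕ.+-suc s N)

module FieldLemmas (F : CommutativeRing 0ℓ 0ℓ) (field′ : IsField F) where
  open CommutativeRing F renaming (_+_ to _⊕_; _*_ to _·_; refl to ≈-refl; sym to ≈-sym; trans to ≈-trans)
  open IsField field′
  open PowerLaws F
  open import Relation.Binary.Reasoning.Setoid setoid

  ·-cancelˡ : ∀ {a x y} → ¬ a ≈ 0# → a · x ≈ a · y → x ≈ y
  ·-cancelˡ {a} {x} {y} a≉0 ax≈ay with inverse a a≉0
  ... | a⁻¹ , aa⁻¹≈1 = begin
    x                ≈⟨ *-identityˡ x ⟨
    1# · x           ≈⟨ *-congʳ (≈-trans (≈-sym aa⁻¹≈1) (*-comm a a⁻¹)) ⟩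
    a⁻¹ · a · x      ≈⟨ *-assoc a⁻¹ a x ⟩
    a⁻¹ · (a · x)    ≈⟨ *-congˡ ax≈ay ⟩
    a⁻¹ · (a · y)    ≈⟨ *-assoc a⁻¹ a y ⟨
    a⁻¹ · a · y      ≈⟨ *-congʳ (≈-trans (*-comm a⁻¹ a) aa⁻¹≈1) ⟩
    1# · y           ≈⟨ *-identityˡ y ⟩
    y                ∎

  ·-nonzero : ∀ {a b} → ¬ a ≈ 0# → ¬ b ≈ 0# → ¬ a · b ≈ 0#
  ·-nonzero {a} a≉0 b≉0 ab≈0 = b≉0 (·-cancelˡ a≉0 (≈-trans ab≈0 (≈-sym (zeroʳ a))))

  pow-nonzero : ∀ {x} n → ¬ x ≈ 0# → ¬ pow F x n ≈ 0#
  pow-nonzero zero    x≉0 = nontrivial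
  pow-nonzero (suc n) x≉0 = ·-nonzero x≉0 (pow-nonzero n x≉0)

  pow-∸≈1# : ∀ {x a b} → ¬ x ≈ 0# → a ≤ b → pow F x a ≈ pow F x b → pow F x (b ∸ a) ≈ 1#
  pow-∸≈1# {x} {a} {b} x≉0 a≤b xᵃ≈xᵇ = ≈-sym (·-cancelˡ (pow-nonzero a x≉0) (begin
    pow F x a · 1#                ≈⟨ *-identityʳ _ ⟩
    pow F x a                     ≈⟨ xᵃ≈xᵇ ⟩
    pow F x b                     ≡⟨ cong (pow F x) (ℕ.m+[n∸m]≡n a≤b) ⟨
    pow F x (a + (b ∸ a))         ≈⟨ pow-homo-* x a (b ∸ a) ⟩
    pow F x a · pow F x (b ∸ a)   ∎))

module NonzeroElements (R : CommutativeRing 0ℓ 0ℓ) {N} (card : HasCardinality R (suc N)) where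
  open CommutativeRing R using (Carrier; _≈_; 0#) renaming (sym to ≈-sym)
  open Inverse card

  private
    to-injective : ∀ {x y} → to x ≡ to y → x ≈ y
    to-injective = Injection.injective (Inverse⇒Injection card)

    to0#≢to : ∀ {x} → ¬ x ≈ 0# → to 0# ≢ to x
    to0#≢to x≉0 to0#≡tox = x≉0 (≈-sym (to-injective to0#≡tox))

    element : Fin N → Carrier
    element i = from (punchIn (to 0#) i)

    element-nonzero : ∀ i → ¬ element i ≈ 0#
    element-nonzero i eᵢ≈0 = punchInᵢ≢i (to 0#) i (trans (sym (strictlyInverseˡ _)) (to-cong eᵢ≈0))

    element-injective : ∀ {i j} → element i ≈ element j → i ≡ j
    element-injective {i} {j} eᵢ≈eⱼ = punchIn-injective (to 0#) i j
      (trans (sym (strictlyInverseˡ _)) (trans (to-cong eᵢ≈eⱼ) (strictlyInverseˡ _)))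

  index : ∀ x → ¬ x ≈ 0# → Fin N
  index x x≉0 = punchOut (to0#≢to x≉0)

  index-injective : ∀ {x y} (x≉0 : ¬ x ≈ 0#) (y≉0 : ¬ y ≈ 0#) → index x x≉0 ≡ index y y≉0 → x ≈ y
  index-injective x≉0 y≉0 same = to-injective (punchOut-injective (to0#≢to x≉0) (to0#≢to y≉0) same)

  nonzero-classifier⇒≤ : ∀ {k} (c : ∀ x → ¬ x ≈ 0# → Fin k) →
                         (∀ {x y} x≉0 y≉0 → c x x≉0 ≡ c y y≉0 → x ≈ y) → N ≤ k
  nonzero-classifier⇒≤ c c-injective = injective⇒≤ λ {i} {j} same →
    element-injective (c-injective (element-nonzero i) (element-nonzero j) same)

module PrimitiveRoot (F : CommutativeRing 0ℓ 0ℓ) (field′ : IsField F) {N} (card : HasCardinality F (suc N))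
                     {g : CommutativeRing.Carrier F} (g-primitive : IsPrimitiveRoot F g) where
  open CommutativeRing F renaming (_+_ to _⊕_; _*_ to _·_; refl to ≈-refl; sym to ≈-sym; trans to ≈-trans)
  open PowerLaws F
  open FieldLemmas F field′
  open NonzeroElements F card

  nonzero : 2 ≤ N → ¬ g ≈ 0#
  nonzero 2≤N g≈0 = ℕ.<⇒≱ 2≤N (nonzero-classifier⇒≤ (λ _ _ → Fin.zero {0})
                                  λ x≉0 y≉0 _ → ≈-trans (≈1# x≉0) (≈-sym (≈1# y≉0)))
    where
    ≈1# : ∀ {x} → ¬ x ≈ 0# → x ≈ 1#
    ≈1# {x} x≉0 with g-primitive x x≉0
    ... | zero  , x≈1 = x≈1
    ... | suc k , x≈g·gᵏ = contradiction (≈-trans x≈g·gᵏ (≈-trans (*-congʳ g≈0) (zeroˡ _))) x≉0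

  -- every nonzero element is g^a for some a < e, as a ↦ a % e preserves g^a
  period⇒N≤ : ∀ e .{{_ : NonZero e}} → pow F g e ≈ 1# → N ≤ e
  period⇒N≤ e gᵉ≈1 = nonzero-classifier⇒≤ (λ x x≉0 → residue (log x x≉0)) residue-injective
    where
    log : ∀ x → ¬ x ≈ 0# → ℕ
    log x x≉0 = proj₁ (g-primitive x x≉0)
    residue : ℕ → Fin e
    residue a = fromℕ< (m%n<n a e)
    residue-injective : ∀ {x y} x≉0 y≉0 → residue (log x x≉0) ≡ residue (log y y≉0) → x ≈ y
    residue-injective {x} {y} x≉0 y≉0 same = begin
      x                            ≈⟨ proj₂ (g-primitive x x≉0) ⟩
      pow F g (log x x≉0)          ≈⟨ pow-% e gᵉ≈1 _ ⟩
      pow F g (log x x≉0 % e)      ≡⟨ cong (pow F g) (fromℕ<-injective _ _ _ _ same) ⟩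
      pow F g (log y y≉0 % e)      ≈⟨ pow-% e gᵉ≈1 _ ⟨
      pow F g (log y y≉0)          ≈⟨ proj₂ (g-primitive y y≉0) ⟨
      y                            ∎
      where open import Relation.Binary.Reasoning.Setoid setoid

  pow-N≈1# : ¬ g ≈ 0# → pow F g N ≈ 1#
  pow-N≈1# g≉0 with pigeonhole (ℕ.n<1+n N) (λ i → index (pow F g (toℕ i)) (pow-nonzero (toℕ i) g≉0))
  ... | i , j , i<j , same = subst (λ e → pow F g e ≈ 1#) (ℕ.≤-antisym e≤N N≤e) gᵉ≈1
    where
    e : ℕ
    e = toℕ j ∸ toℕ i
    gᵉ≈1 : pow F g e ≈ 1#
    gᵉ≈1 = pow-∸≈1# g≉0 (ℕ.<⇒≤ i<j) (index-injective (pow-nonzero (toℕ i) g≉0) (pow-nonzero (toℕ j) g≉0) same)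
    e≤N : e ≤ N
    e≤N = ℕ.≤-trans (ℕ.m∸n≤m (toℕ j) (toℕ i)) (ℕ.≤-pred (toℕ<n j))
    N≤e : N ≤ e
    N≤e = period⇒N≤ e {{>-nonZero (ℕ.m<n⇒0<n∸m i<j)}} gᵉ≈1

  pow-distinct : ¬ g ≈ 0# → ∀ {a b} → a < b → b < N → ¬ pow F g a ≈ pow F g b
  pow-distinct g≉0 {a} {b} a<b b<N gᵃ≈gᵇ =
    ℕ.<⇒≱ (ℕ.≤-<-trans (ℕ.m∸n≤m b a) b<N)
          (period⇒N≤ (b ∸ a) {{>-nonZero (ℕ.m<n⇒0<n∸m a<b)}} (pow-∸≈1# g≉0 (ℕ.<⇒≤ a<b) gᵃ≈gᵇ))

  pow-injective-< : ¬ g ≈ 0# → ∀ {a b} → a < N → b < N → pow F g a ≈ pow F g b → a ≡ b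
  pow-injective-< g≉0 {a} {b} a<N b<N gᵃ≈gᵇ with ℕ.<-cmp a b
  ... | tri< a<b _ _ = contradiction gᵃ≈gᵇ (pow-distinct g≉0 a<b b<N)
  ... | tri≈ _ a≡b _ = a≡b
  ... | tri> _ _ b<a = contradiction (≈-sym gᵃ≈gᵇ) (pow-distinct g≉0 b<a a<N)

  pow-injective-% : ¬ g ≈ 0# → .{{_ : NonZero N}} → ∀ {a b} → pow F g a ≈ pow F g b → a % N ≡ b % N
  pow-injective-% g≉0 {a} {b} gᵃ≈gᵇ = pow-injective-< g≉0 (m%n<n a N) (m%n<n b N)
    (≈-trans (≈-sym (pow-% N gᴺ≈1 a)) (≈-trans gᵃ≈gᵇ (pow-% N gᴺ≈1 b)))
    where
    gᴺ≈1 : pow F g N ≈ 1#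
    gᴺ≈1 = pow-N≈1# g≉0

  InCyclotomicClass⇒index : ¬ g ≈ 0# → ∀ {M} .{{_ : NonZero M}} .{{_ : NonZero N}} → M ∣ N →
                            ∀ {j y a} → InCyclotomicClass F g M j y → y ≈ pow F g a → toℕ j ≡ a % M
  InCyclotomicClass⇒index g≉0 {M} M∣N {j} {y} {a} (k , m , refl , y≈gᵏ) y≈gᵃ = begin
    toℕ j                     ≡⟨ m<n⇒m%n≡m (toℕ<n j) ⟨
    toℕ j % M                 ≡⟨ [m+kn]%n≡m%n (toℕ j) m M ⟨
    (toℕ j + m * M) % M       ≡⟨ cong (_% M) (ℕ.+-comm (toℕ j) (m * M)) ⟩
    (m * M + toℕ j) % M       ≡⟨ m∣n⇒o%n%m≡o%m M N _ M∣N ⟨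
    (m * M + toℕ j) % N % M   ≡⟨ cong (_% M) (pow-injective-% g≉0 (≈-trans (≈-sym y≈gᵏ) y≈gᵃ)) ⟩
    a % N % M                 ≡⟨ m∣n⇒o%n%m≡o%m M N a M∣N ⟩
    a % M                     ∎
    where open ≡-Reasoning

clique⇒evens⊆I : (F : CommutativeRing 0ℓ 0ℓ) → IsField F → ∀ {M s} .{{_ : NonZero M}} →
                 2 ≤ s → s ≡1[mod M ] → HasCardinality F (s * s) →
                 (g : CommutativeRing.Carrier F) → IsPrimitiveRoot F g →
                 (I : Subset M) → IsClique F g M I (InSubfield F s) → ∀ j → 2 ∣ toℕ j → j ∈ I
clique⇒evens⊆I F field′ {M} {s} 2≤s s≡1 card g g-primitive I clique j (divides e toℕj≡e*2) =
  subst (_∈ I) (toℕ-injective toℕj′≡toℕj) j′∈I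
  where
  open CommutativeRing F renaming (_+_ to _⊕_; _*_ to _·_; refl to ≈-refl; sym to ≈-sym; trans to ≈-trans)
  open import Algebra.Properties.Ring ring using (-0#≈0#)
  open PowerLaws F
  open FieldLemmas F field′

  K : ℕ
  K = proj₁ (≡1[mod]-* s≡1 s≡1)

  N : ℕ
  N = K * M

  s*s≡1+N : s * s ≡ suc N
  s*s≡1+N = proj₂ (≡1[mod]-* s≡1 s≡1)

  3≤N : 3 ≤ N
  3≤N = ℕ.≤-pred (subst (4 ≤_) s*s≡1+N (ℕ.*-mono-≤ 2≤s 2≤s))

  instance
    N≢0 : NonZero N
    N≢0 = >-nonZero (ℕ.≤-trans (s≤s z≤n) 3≤N)

  open PrimitiveRoot F field′ (subst (HasCardinality F) s*s≡1+N card) g-primitive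

  g≉0 : ¬ g ≈ 0#
  g≉0 = nonzero (ℕ.<⇒≤ 3≤N)

  x : Carrier
  x = pow F (pow F g (1 + s)) e

  x∈subfield : InSubfield F s x
  x∈subfield = InSubfield-pow {s} e (pow[1+s]-InSubfield {s} s*s≡1+N (pow-N≈1# g≉0))

  x≉0 : ¬ x ≈ 0#
  x≉0 = pow-nonzero e (pow-nonzero (1 + s) g≉0)

  x-0#≈g^[[1+s]*e] : x - 0# ≈ pow F g ((1 + s) * e)
  x-0#≈g^[[1+s]*e] = ≈-trans (≈-trans (+-congˡ -0#≈0#) (+-identityʳ x)) (pow-assocʳ g (1 + s) e)

  adjacent : PPAdj F g M I x 0#
  adjacent = clique x 0# x∈subfield (0#-InSubfield (ℕ.<⇒≤ 2≤s)) x≉0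

  j′ : Fin M
  j′ = proj₁ adjacent

  j′∈I : j′ ∈ I
  j′∈I = proj₁ (proj₂ adjacent)

  toℕj′≡toℕj : toℕ j′ ≡ toℕ j
  toℕj′≡toℕj = begin
    toℕ j′               ≡⟨ InCyclotomicClass⇒index g≉0 (divides K refl) (proj₂ (proj₂ adjacent)) x-0#≈g^[[1+s]*e] ⟩
    (1 + s) * e % M      ≡⟨ [1+s]*e≡e*2[mod] s≡1 e ⟩
    e * 2 % M            ≡⟨ cong (_% M) toℕj≡e*2 ⟨
    toℕ j % M            ≡⟨ m<n⇒m%n≡m (toℕ<n j) ⟩
    toℕ j                ∎
    where open ≡-Reasoning

lemma5p2 : (p d t r : ℕ) → Prime p → ¬ (2 ∣ p) → 1 ≤ d
    → 1 ≤ t → (2 * d) ∣ (p ^ t + 1)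
    → (∀ s → 1 ≤ s → s < t → ¬ ((2 * d) ∣ (p ^ s + 1)))
    → 1 ≤ r → 2 ∣ r
    → (I : Subset (2 * d)) → ∣ I ∣ ≡ d
    → ¬ (∀ (j : Fin (2 * d)) → ((j ∈ I → 2 ∣ toℕ j) × (2 ∣ toℕ j → j ∈ I)))
    → (F : CommutativeRing 0ℓ 0ℓ) → IsField F → HasCardinality F (p ^ (2 * r * t))
    → (g : CommutativeRing.Carrier F) → IsPrimitiveRoot F g
    → ¬ IsClique F g (2 * d) I (InSubfield F (p ^ (r * t)))
lemma5p2 p d t r p-prime _ 1≤d 1≤t 2d∣pᵗ+1 _ 1≤r 2∣r I ∣I∣≡d I≢evens F field′ card g g-primitive clique =
  I≢evens λ j → ⊇evens⇒⊆evens d I ∣I∣≡d evens⊆I j , evens⊆I j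
  where
  instance
    p≢0 : NonZero p
    p≢0 = prime⇒nonZero p-prime
    2d≢0 : NonZero (2 * d)
    2d≢0 = ℕ.m*n≢0 2 d {{_}} {{>-nonZero 1≤d}}

  s : ℕ
  s = p ^ (r * t)

  s≡1 : s ≡1[mod 2 * d ]
  s≡1 = subst (_≡1[mod 2 * d ]) (trans (ℕ.^-*-assoc p t r) (cong (p ^_) (ℕ.*-comm t r)))
              (^even≡1[mod] (p ^ t) {{ℕ.m^n≢0 p t}} r 2d∣pᵗ+1 2∣r)

  2≤s : 2 ≤ s
  2≤s = ℕ.≤-trans (nonTrivial⇒n>1 p {{prime⇒nonTrivial p-prime}})
                  (subst (_≤ s) (ℕ.*-identityʳ p) (ℕ.^-monoʳ-≤ p (ℕ.*-mono-≤ 1≤r 1≤t)))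

  q≡s*s : p ^ (2 * r * t) ≡ s * s
  q≡s*s = trans (cong (p ^_) (double r t)) (ℕ.^-distribˡ-+-* p (r * t) (r * t))
    where
    double : ∀ r t → 2 * r * t ≡ r * t + r * t
    double = solve-∀

  evens⊆I : ∀ j → 2 ∣ toℕ j → j ∈ I
  evens⊆I = clique⇒evens⊆I F field′ 2≤s s≡1 (subst (HasCardinality F) q≡s*s card) g g-primitive I clique
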